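{- Let $G$ and $H$ be connected graphs such that the join $G\vee H$ is not complete. Then $tpc(G\vee H)=3$.
   Context: All graphs are simple, finite and undirected. A graph is total-colored if all its vertices and edges are assigned colors. A path in a total-colored graph is a total proper path if (i) any two adjacent edges on the path differ in color, (ii) any two adjacent internal vertices of the path differ in color, and (iii) every internal vertex of the path differs in color from the edges of the path incident with it. A total-colored graph is total-proper connected if any two vertices are joined by a total proper path. For a connected graph $G$, the total proper connection number $tpc(G)$ is the smallest number of colors in a total-coloring making $G$ total-proper connected. The join $G\vee H$ has vertex set $V(G)\cup V(H)$ (disjoint union) and edge set $E(G)\cup E(H)\cup\{uv: u\in V(G), v\in V(H)\}$. -}

module Defs where

open import Data.Nat using (ℕ; _+_; _<_; NonZero)
open import Data.Fin using (Fin; splitAt)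
open import Data.Bool using (Bool; true; false)
open import Data.Sum using (_⊎_; inj₁; inj₂)
open import Data.Product using (Σ; _×_; ∃; _,_)
open import Data.Unit using (⊤)
open import Data.Maybe using (Maybe; just)
open import Data.List using (List; []; _∷_; head; last)
open import Data.List.Relation.Unary.Linked using (Linked)
open import Data.List.Relation.Unary.Unique.Propositional using (Unique)
open import Relation.Binary.PropositionalEquality using (_≡_; _≢_)
open import Relation.Nullary using (¬_)

record Graph : Set where
  field
    n     : ℕ
    adj   : Fin n → Fin n → Bool
    sym   : ∀ u v → adj u v ≡ adj v u
    irrefl : ∀ v → adj v v ≡ false

open Graph public

Adj : (G : Graph) → Fin (n G) → Fin (n G) → Set
Adj G u v = adj G u v ≡ true

IsWalk : (G : Graph) → Fin (n G) → Fin (n G) → List (Fin (n G)) → Set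
IsWalk G x y p = Linked (Adj G) p × head p ≡ just x × last p ≡ just y

IsPath : (G : Graph) → Fin (n G) → Fin (n G) → List (Fin (n G)) → Set
IsPath G x y p = IsWalk G x y p × Unique p

Connected : Graph → Set
Connected G = NonZero (n G) × (∀ x y → ∃ λ p → IsWalk G x y p)

Complete : Graph → Set
Complete G = ∀ u v → u ≢ v → Adj G u v

joinAdj : (G H : Graph) → Fin (n G + n H) → Fin (n G + n H) → Bool
joinAdj G H u v with splitAt (n G) u | splitAt (n G) v
... | inj₁ a | inj₁ b = adj G a b
... | inj₂ a | inj₂ b = adj H a b
... | inj₁ _ | inj₂ _ = true
... | inj₂ _ | inj₁ _ = true

joinSym : (G H : Graph) → ∀ u v → joinAdj G H u v ≡ joinAdj G H v u
joinSym G H u v with splitAt (n G) u | splitAt (n G) v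
... | inj₁ a | inj₁ b = sym G a b
... | inj₂ a | inj₂ b = sym H a b
... | inj₁ _ | inj₂ _ = _≡_.refl
... | inj₂ _ | inj₁ _ = _≡_.refl

joinIrrefl : (G H : Graph) → ∀ v → joinAdj G H v v ≡ false
joinIrrefl G H v with splitAt (n G) v
... | inj₁ a = irrefl G a
... | inj₂ a = irrefl H a

_∨ᴳ_ : Graph → Graph → Graph
G ∨ᴳ H = record
  { n = n G + n H
  ; adj = joinAdj G H
  ; sym = joinSym G H
  ; irrefl = joinIrrefl G H
  }

-- Edge colors are given on unordered pairs, i.e. by a symmetric function
-- (its values on non-adjacent pairs are irrelevant).
record TotalColoring (G : Graph) (k : ℕ) : Set where
  field
    vcol : Fin (n G) → Fin k
    ecol : Fin (n G) → Fin (n G) → Fin k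
    ecol-sym : ∀ u v → ecol u v ≡ ecol v u

open TotalColoring public

module _ {G : Graph} {k : ℕ} (c : TotalColoring G k) where
  -- conditions (i) and (iii): for consecutive vertices a b c on the path,
  -- b is internal; edges ab, bc differ, and b differs from both edges.
  Cond3 : List (Fin (n G)) → Set
  Cond3 (a ∷ b ∷ d ∷ rest) =
    (ecol c a b ≢ ecol c b d × vcol c b ≢ ecol c a b × vcol c b ≢ ecol c b d)
    × Cond3 (b ∷ d ∷ rest)
  Cond3 _ = ⊤

  -- condition (ii): for consecutive vertices a b d e, b and d are
  -- adjacent internal vertices and must differ in color.
  Cond4 : List (Fin (n G)) → Set
  Cond4 (a ∷ b ∷ d ∷ e ∷ rest) = vcol c b ≢ vcol c d × Cond4 (b ∷ d ∷ e ∷ rest)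
  Cond4 _ = ⊤

  IsTotalProperPath : Fin (n G) → Fin (n G) → List (Fin (n G)) → Set
  IsTotalProperPath x y p = IsPath G x y p × Cond3 p × Cond4 p

TotalProperConnected : (G : Graph) {k : ℕ} → TotalColoring G k → Set
TotalProperConnected G c = ∀ x y → ∃ λ p → IsTotalProperPath c x y p

TPCWith : Graph → ℕ → Set
TPCWith G k = Σ (TotalColoring G k) λ c → TotalProperConnected G c

TpcIs : Graph → ℕ → Set
TpcIs G k = TPCWith G k × (∀ j → j < k → ¬ TPCWith G j)

-- Fewer than three colours never suffice: an internal vertex of a total proper
-- path sees three pairwise distinct colours (its two edges and itself), so with
-- at most two colours only adjacent vertices are joined, and G ∨ H is not
-- complete.  For three colours, give every vertex of G the parity of its
-- breadth-first distance from a root g₀, so that each vertex of G has a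
-- neighbour of the other parity, and likewise for H with root h₀.  Colour the
-- edges of G with 0 and use the H-vertex h₀ (coloured 0) as a hub: the spoke
-- from a vertex a of G to h₀ gets colour 1 or 2 according to the parity of a,
-- and a itself the other of these two colours.  Two vertices of G of different
-- parity are joined through h₀; if their parities agree, first step from one
-- of them to a neighbour of the other parity.  Symmetrically H is served by the
-- hub g₀ with the colours 2 (edges of H and g₀), 1 and 0, and the two
-- descriptions agree on the edge g₀h₀.  Vertices on different sides are
-- adjacent.
module Submission where

open import Defs hiding (sym; irrefl)
open import Data.Bool using (true)
import Data.Bool.Properties as Bool
open import Data.Empty using (⊥-elim)
open import Data.Fin using (Fin; splitAt; join; _↑ˡ_; _↑ʳ_; fromℕ<; _≟_)
open import Data.Fin.Patterns using (0F; 1F; 2F)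
open import Data.Fin.Properties using (any?; splitAt-join; join-splitAt; ↑ˡ-injective; ↑ʳ-injective)
open import Data.List using ([]; _∷_; last)
open import Data.List.Relation.Unary.AllPairs using ([]; _∷_)
open import Data.List.Relation.Unary.All using ([]; _∷_)
open import Data.List.Relation.Unary.Linked using (Linked; [-]; _∷_)
open import Data.Maybe using (just)
open import Data.Nat using (ℕ; zero; suc; _<_; _≤_; s≤s; s≤s⁻¹; z≤n; >-nonZero⁻¹; parity)
open import Data.Nat.Induction using (<-rec)
open import Data.Nat.Properties using (anyUpTo?; ≮⇒≥; <⇒≱; ≤-antisym; n≤0⇒n≡0; n≢0⇒n>0)
open import Data.Parity using (Parity; 0ℙ; 1ℙ; _⁻¹)
import Data.Parity.Properties as Parity
open import Data.Product using (∃; _×_; _,_; -,_; proj₁; proj₂)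
open import Data.Sum using (_⊎_; inj₁; inj₂; fromInj₂)
open import Data.Unit using (tt)
open import Function using (_∘_)
open import Function.Definitions using (Injective)
open import Relation.Binary.PropositionalEquality
  using (_≡_; _≢_; refl; sym; trans; cong; cong₂; subst; subst₂; ≢-sym)
open import Relation.Nullary using (¬_; yes; no; _×-dec_)
open import Relation.Unary using (Decidable)

Adj-sym : (G : Graph) → ∀ {u v} → Adj G u v → Adj G v u
Adj-sym G {u} {v} uv = trans (Graph.sym G v u) uv

Adj⇒≢ : (G : Graph) → ∀ {u v} → Adj G u v → u ≢ v
Adj⇒≢ G {u} uu refl with () ← trans (sym (Graph.irrefl G u)) uu

≢-resp : ∀ {A : Set} {a a′ b b′ : A} → a ≡ a′ → b ≡ b′ → a′ ≢ b′ → a ≢ b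
≢-resp refl refl a′≢b′ = a′≢b′

Least : (ℕ → Set) → ℕ → Set
Least P k = P k × (∀ {j} → j < k → ¬ P j)

least : {P : ℕ → Set} → Decidable P → ∃ P → ∃ (Least P)
least {P} P? (m , pm) = <-rec (λ m → P m → ∃ (Least P)) search m pm
  where
  search : ∀ m → (∀ {j} → j < m → P j → ∃ (Least P)) → P m → ∃ (Least P)
  search m below pm with anyUpTo? P? m
  ... | yes (j , j<m , pj) = below j<m pj
  ... | no none            = m , pm , λ j<m pj → none (-, j<m , pj)

-- The vertex y only witnesses that G has more than one vertex.
Alternating : (G : Graph) → (Fin (n G) → Parity) → Set
Alternating G β = ∀ x y → x ≢ y → ∃ λ u → Adj G x u × β u ≢ β x

parity-suc≢ : ∀ m → parity (suc m) ≢ parity m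
parity-suc≢ m eq = Parity.p≢p⁻¹ (parity (suc m)) (trans eq (sym (Parity.suc-homo-⁻¹ m)))

module BreadthFirst (G : Graph) (r : Fin (n G)) (walk-from-root : ∀ v → ∃ (IsWalk G r v)) where

  ReachableIn : ℕ → Fin (n G) → Set
  ReachableIn zero    v = v ≡ r
  ReachableIn (suc k) v = ∃ λ u → ReachableIn k u × Adj G u v

  reachableIn? : ∀ k → Decidable (ReachableIn k)
  reachableIn? zero    v = v ≟ r
  reachableIn? (suc k) v = any? λ u → reachableIn? k u ×-dec adj G u v Bool.≟ true

  reachable-along : ∀ {k u v} rest → Linked (Adj G) (u ∷ rest) → last (u ∷ rest) ≡ just v →
                    ReachableIn k u → ∃ λ m → ReachableIn m v
  reachable-along []         _          refl ru = -, ru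
  reachable-along (w ∷ rest) (uw ∷ uws) ends ru = reachable-along rest uws ends (-, ru , uw)

  shortest : ∀ v → ∃ (Least (λ k → ReachableIn k v))
  shortest v with walk-from-root v
  ... | (_ ∷ rest) , linked , refl , ends =
    least (λ k → reachableIn? k v) (reachable-along rest linked ends refl)

  dist : Fin (n G) → ℕ
  dist v = proj₁ (shortest v)

  reachableIn-dist : ∀ v → ReachableIn (dist v) v
  reachableIn-dist v = proj₁ (proj₂ (shortest v))

  dist-minimal : ∀ {k v} → ReachableIn k v → dist v ≤ k
  dist-minimal {v = v} rk = ≮⇒≥ λ k<dist → proj₂ (proj₂ (shortest v)) k<dist rk

  dist≡0⇒root : ∀ {v} → dist v ≡ 0 → v ≡ r
  dist≡0⇒root {v} dist≡0 = subst (λ k → ReachableIn k v) dist≡0 (reachableIn-dist v)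

  dist-root : dist r ≡ 0
  dist-root = n≤0⇒n≡0 (dist-minimal {0} refl)

  dist-parent : ∀ {k v} → dist v ≡ suc k → ∃ λ u → Adj G u v × dist u ≡ k
  dist-parent {k} {v} dist≡ with subst (λ k → ReachableIn k v) dist≡ (reachableIn-dist v)
  ... | u , ru , uv = u , uv , ≤-antisym (dist-minimal ru)
    (s≤s⁻¹ (subst (_≤ suc (dist u)) dist≡ (dist-minimal (u , reachableIn-dist u , uv))))

  dist-root-child : ∀ {v} → v ≢ r → ∃ λ u → Adj G r u × dist u ≡ 1
  dist-root-child {v} v≢r with walk-from-root v
  ... | (_ ∷ [])    , _        , refl , refl = ⊥-elim (v≢r refl)
  ... | (_ ∷ u ∷ _) , (ru ∷ _) , refl , _    = u , ru ,
    ≤-antisym (dist-minimal (r , refl , ru)) (n≢0⇒n>0 (Adj⇒≢ G ru ∘ sym ∘ dist≡0⇒root))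

  dist-neighbour : ∀ x y → x ≢ y →
                   ∃ λ u → Adj G x u × (dist x ≡ suc (dist u) ⊎ dist u ≡ suc (dist x))
  dist-neighbour x y x≢y with dist x in dist≡
  ... | suc _ = let u , ux , dist-u = dist-parent dist≡ in
    u , Adj-sym G ux , inj₁ (cong suc (sym dist-u))
  ... | zero with refl ← dist≡0⇒root dist≡ =
    let u , xu , dist-u = dist-root-child (≢-sym x≢y) in u , xu , inj₂ dist-u

  dist-parity-alternating : Alternating G (parity ∘ dist)
  dist-parity-alternating x y x≢y with dist-neighbour x y x≢y
  ... | u , xu , inj₁ dist-x = u , xu , λ eq →
    parity-suc≢ (dist u) (trans (cong parity (sym dist-x)) (sym eq))
  ... | u , xu , inj₂ dist-u = u , xu , λ eq →
    parity-suc≢ (dist x) (trans (cong parity (sym dist-u)) eq)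

  dist-parity-root : parity (dist r) ≡ 0ℙ
  dist-parity-root = cong parity dist-root

three-distinct⇒3≤ : ∀ {k} (x y z : Fin k) → x ≢ y → y ≢ z → x ≢ z → 3 ≤ k
three-distinct⇒3≤ {suc (suc (suc _))} _ _ _ _ _ _ = s≤s (s≤s (s≤s z≤n))
three-distinct⇒3≤ {1} 0F 0F _  x≢y _ _ = ⊥-elim (x≢y refl)
three-distinct⇒3≤ {2} 0F 0F _  x≢y _ _ = ⊥-elim (x≢y refl)
three-distinct⇒3≤ {2} 1F 1F _  x≢y _ _ = ⊥-elim (x≢y refl)
three-distinct⇒3≤ {2} 0F 1F 1F _ y≢z _ = ⊥-elim (y≢z refl)
three-distinct⇒3≤ {2} 1F 0F 0F _ y≢z _ = ⊥-elim (y≢z refl)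
three-distinct⇒3≤ {2} 0F 1F 0F _ _ x≢z = ⊥-elim (x≢z refl)
three-distinct⇒3≤ {2} 1F 0F 1F _ _ x≢z = ⊥-elim (x≢z refl)

module _ {J : Graph} {k : ℕ} (c : TotalColoring J k) where

  ProperAt : (a b d : Fin (n J)) → Set
  ProperAt a b d = ecol c a b ≢ ecol c b d × vcol c b ≢ ecol c a b × vcol c b ≢ ecol c b d

  ProperAt⇒3≤ : ∀ {a b d} → ProperAt a b d → 3 ≤ k
  ProperAt⇒3≤ (ab≢bd , b≢ab , b≢bd) = three-distinct⇒3≤ _ _ _ ab≢bd (≢-sym b≢bd) (≢-sym b≢ab)

  tpp-trivial : ∀ x → IsTotalProperPath c x x (x ∷ [])
  tpp-trivial x = (([-] , refl , refl) , [] ∷ []) , tt , tt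

  tpp-edge : ∀ {x y} → Adj J x y → IsTotalProperPath c x y (x ∷ y ∷ [])
  tpp-edge xy = (((xy ∷ [-]) , refl , refl) , (Adj⇒≢ J xy ∷ []) ∷ [] ∷ []) , tt , tt

  tpp₃ : ∀ {x h y} → Adj J x h → Adj J h y → x ≢ y → ProperAt x h y →
         IsTotalProperPath c x y (x ∷ h ∷ y ∷ [])
  tpp₃ xh hy x≢y proper =
    (((xh ∷ hy ∷ [-]) , refl , refl) ,
      (Adj⇒≢ J xh ∷ x≢y ∷ []) ∷ (Adj⇒≢ J hy ∷ []) ∷ [] ∷ []) ,
    (proper , tt) , tt

  tpp₄ : ∀ {x u h y} → Adj J x u → Adj J u h → Adj J h y → x ≢ h → x ≢ y → u ≢ y →
         ProperAt x u h → ProperAt u h y → vcol c u ≢ vcol c h →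
         IsTotalProperPath c x y (x ∷ u ∷ h ∷ y ∷ [])
  tpp₄ xu uh hy x≢h x≢y u≢y proper-u proper-h u≢h =
    (((xu ∷ uh ∷ hy ∷ [-]) , refl , refl) ,
      (Adj⇒≢ J xu ∷ x≢h ∷ x≢y ∷ []) ∷ (Adj⇒≢ J uh ∷ u≢y ∷ []) ∷ (Adj⇒≢ J hy ∷ []) ∷ [] ∷ []) ,
    (proper-u , proper-h , tt) , (u≢h , tt)

  tpp-short : k < 3 → ∀ {x y} p → IsTotalProperPath c x y p → x ≡ y ⊎ Adj J x y
  tpp-short k<3 []              (((_ , () , _) , _) , _)
  tpp-short k<3 (_ ∷ [])        (((_ , refl , refl) , _) , _) = inj₁ refl
  tpp-short k<3 (_ ∷ _ ∷ [])    ((((xy ∷ _) , refl , refl) , _) , _) = inj₂ xy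
  tpp-short k<3 (_ ∷ _ ∷ _ ∷ _) (_ , (proper , _) , _) = ⊥-elim (<⇒≱ k<3 (ProperAt⇒3≤ proper))

tpc-lower-bound : (J : Graph) → ¬ Complete J → ∀ j → j < 3 → ¬ TPCWith J j
tpc-lower-bound J incomplete j j<3 (c , connected) = incomplete λ u v u≢v →
  fromInj₂ (⊥-elim ∘ u≢v) (tpp-short c j<3 (proj₁ (connected u v)) (proj₂ (connected u v)))

select : {A : Set} → Parity → A → A → A
select 0ℙ x y = x
select 1ℙ x y = y

select-injective : ∀ {A : Set} {p q : A} → p ≢ q → Injective _≡_ _≡_ (λ β → select β p q)
select-injective p≢q {0ℙ} {0ℙ} _   = refl
select-injective p≢q {0ℙ} {1ℙ} p≡q = ⊥-elim (p≢q p≡q)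
select-injective p≢q {1ℙ} {0ℙ} q≡p = ⊥-elim (p≢q (sym q≡p))
select-injective p≢q {1ℙ} {1ℙ} _   = refl

≢-select : ∀ {A : Set} {e p q : A} → e ≢ p → e ≢ q → ∀ β → e ≢ select β p q
≢-select e≢p e≢q 0ℙ = e≢p
≢-select e≢p e≢q 1ℙ = e≢q

select-⁻¹-≢ : ∀ {A : Set} {p q : A} → p ≢ q → ∀ β → select (β ⁻¹) p q ≢ select β p q
select-⁻¹-≢ p≢q β eq = Parity.p≢p⁻¹ β (sym (select-injective p≢q eq))

module Hub {J : Graph} {k : ℕ} (c : TotalColoring J k)
  {K : Graph} (ι : Fin (n K) → Fin (n J)) (ι-injective : Injective _≡_ _≡_ ι)
  (ι-adj : ∀ {a b} → Adj K a b → Adj J (ι a) (ι b))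
  (h : Fin (n J)) (h-adj : ∀ a → Adj J (ι a) h)
  (β : Fin (n K) → Parity) (β-alternating : Alternating K β)
  (e p q : Fin k) (e≢p : e ≢ p) (e≢q : e ≢ q) (p≢q : p ≢ q)
  (vcol-h : vcol c h ≡ e)
  (ecol-ι : ∀ {a b} → Adj K a b → ecol c (ι a) (ι b) ≡ e)
  (ecol-spoke : ∀ a → ecol c (ι a) h ≡ select (β a) p q)
  (vcol-ι : ∀ a → vcol c (ι a) ≡ select (β a ⁻¹) p q)
  where

  ecol-spokeᵒ : ∀ a → ecol c h (ι a) ≡ select (β a) p q
  ecol-spokeᵒ a = trans (ecol-sym c h (ι a)) (ecol-spoke a)

  h≢spoke : ∀ a → vcol c h ≢ ecol c (ι a) h
  h≢spoke a = ≢-resp vcol-h (ecol-spoke a) (≢-select e≢p e≢q (β a))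

  h≢spokeᵒ : ∀ a → vcol c h ≢ ecol c h (ι a)
  h≢spokeᵒ a = ≢-resp vcol-h (ecol-spokeᵒ a) (≢-select e≢p e≢q (β a))

  spokes≢ : ∀ {a b} → β a ≢ β b → ecol c (ι a) h ≢ ecol c h (ι b)
  spokes≢ βa≢βb = ≢-resp (ecol-spoke _) (ecol-spokeᵒ _) (βa≢βb ∘ select-injective p≢q)

  through-hub : ∀ {a b} → a ≢ b → β a ≢ β b →
                IsTotalProperPath c (ι a) (ι b) (ι a ∷ h ∷ ι b ∷ [])
  through-hub {a} {b} a≢b βa≢βb =
    tpp₃ c (h-adj a) (Adj-sym J (h-adj b)) (a≢b ∘ ι-injective)
      (spokes≢ βa≢βb , h≢spoke a , h≢spokeᵒ b)

  via-neighbour : ∀ {a u b} → Adj K a u → a ≢ b → β u ≢ β b →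
                  IsTotalProperPath c (ι a) (ι b) (ι a ∷ ι u ∷ h ∷ ι b ∷ [])
  via-neighbour {a} {u} {b} au a≢b βu≢βb =
    tpp₄ c (ι-adj au) (h-adj u) (Adj-sym J (h-adj b))
      (Adj⇒≢ J (h-adj a)) (a≢b ∘ ι-injective) (λ ιu≡ιb → βu≢βb (cong β (ι-injective ιu≡ιb)))
      ( ≢-resp (ecol-ι au) (ecol-spoke u) (≢-select e≢p e≢q (β u))
      , ≢-resp (vcol-ι u) (ecol-ι au) (≢-sym (≢-select e≢p e≢q (β u ⁻¹)))
      , ≢-resp (vcol-ι u) (ecol-spoke u) (select-⁻¹-≢ p≢q (β u)) )
      (spokes≢ βu≢βb , h≢spoke u , h≢spokeᵒ b)
      (≢-resp (vcol-ι u) vcol-h (≢-sym (≢-select e≢p e≢q (β u ⁻¹))))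

  hub-connects : ∀ a b → ∃ (IsTotalProperPath c (ι a) (ι b))
  hub-connects a b with a ≟ b
  ... | yes refl = -, tpp-trivial c (ι a)
  ... | no a≢b with β a Parity.≟ β b
  ...   | no βa≢βb = -, through-hub a≢b βa≢βb
  ...   | yes βa≡βb with β-alternating a b a≢b
  ...     | u , au , βu≢βa =
    -, via-neighbour au a≢b (λ βu≡βb → βu≢βa (trans βu≡βb (sym βa≡βb)))

module _ (G H : Graph) where

  join-adjˡˡ : ∀ {a b} → Adj G a b → Adj (G ∨ᴳ H) (a ↑ˡ n H) (b ↑ˡ n H)
  join-adjˡˡ {a} {b} ab
    rewrite splitAt-join (n G) (n H) (inj₁ a) | splitAt-join (n G) (n H) (inj₁ b) = ab

  join-adjʳʳ : ∀ {a b} → Adj H a b → Adj (G ∨ᴳ H) (n G ↑ʳ a) (n G ↑ʳ b)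
  join-adjʳʳ {a} {b} ab
    rewrite splitAt-join (n G) (n H) (inj₂ a) | splitAt-join (n G) (n H) (inj₂ b) = ab

  join-adjˡʳ : ∀ a b → Adj (G ∨ᴳ H) (a ↑ˡ n H) (n G ↑ʳ b)
  join-adjˡʳ a b
    rewrite splitAt-join (n G) (n H) (inj₁ a) | splitAt-join (n G) (n H) (inj₂ b) = refl

  join-adjʳˡ : ∀ a b → Adj (G ∨ᴳ H) (n G ↑ʳ b) (a ↑ˡ n H)
  join-adjʳˡ a b = Adj-sym (G ∨ᴳ H) (join-adjˡʳ a b)

module JoinColouring (G H : Graph) {g₀ : Fin (n G)} {h₀ : Fin (n H)}
  (βG : Fin (n G) → Parity) (βH : Fin (n H) → Parity)
  (βG-g₀ : βG g₀ ≡ 0ℙ) (βH-h₀ : βH h₀ ≡ 0ℙ)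
  (βG-alternating : Alternating G βG) (βH-alternating : Alternating H βH)
  where

  -- The edge g₀h₀ is a spoke of both hubs; its two prescribed colours agree.
  cross : Fin (n G) → Fin (n H) → Fin 3
  cross a b with b ≟ h₀ | a ≟ g₀
  ... | yes _ | _     = select (βG a) 1F 2F
  ... | no _  | yes _ = select (βH b) 1F 0F
  ... | no _  | no _  = 0F

  cross-to-h₀ : ∀ a → cross a h₀ ≡ select (βG a) 1F 2F
  cross-to-h₀ a with h₀ ≟ h₀ | a ≟ g₀
  ... | yes _     | _ = refl
  ... | no h₀≢h₀ | _ = ⊥-elim (h₀≢h₀ refl)

  cross-from-g₀ : ∀ b → cross g₀ b ≡ select (βH b) 1F 0F
  cross-from-g₀ b with b ≟ h₀ | g₀ ≟ g₀
  ... | yes refl | _        rewrite βG-g₀ | βH-h₀ = refl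
  ... | no _     | yes _    = refl
  ... | no _     | no g₀≢g₀ = ⊥-elim (g₀≢g₀ refl)

  vertexColour : Fin (n G) ⊎ Fin (n H) → Fin 3
  vertexColour (inj₁ a) = select (βG a ⁻¹) 1F 2F
  vertexColour (inj₂ b) = select (βH b ⁻¹) 1F 0F

  edgeColour : Fin (n G) ⊎ Fin (n H) → Fin (n G) ⊎ Fin (n H) → Fin 3
  edgeColour (inj₁ _) (inj₁ _) = 0F
  edgeColour (inj₂ _) (inj₂ _) = 2F
  edgeColour (inj₁ a) (inj₂ b) = cross a b
  edgeColour (inj₂ b) (inj₁ a) = cross a b

  edgeColour-sym : ∀ s t → edgeColour s t ≡ edgeColour t s
  edgeColour-sym (inj₁ _) (inj₁ _) = refl
  edgeColour-sym (inj₂ _) (inj₂ _) = refl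
  edgeColour-sym (inj₁ _) (inj₂ _) = refl
  edgeColour-sym (inj₂ _) (inj₁ _) = refl

  colouring : TotalColoring (G ∨ᴳ H) 3
  colouring = record
    { vcol     = vertexColour ∘ splitAt (n G)
    ; ecol     = λ u v → edgeColour (splitAt (n G) u) (splitAt (n G) v)
    ; ecol-sym = λ u v → edgeColour-sym (splitAt (n G) u) (splitAt (n G) v)
    }

  vcol-join : ∀ s → vcol colouring (join (n G) (n H) s) ≡ vertexColour s
  vcol-join s = cong vertexColour (splitAt-join (n G) (n H) s)

  ecol-join : ∀ s t → ecol colouring (join (n G) (n H) s) (join (n G) (n H) t) ≡ edgeColour s t
  ecol-join s t = cong₂ edgeColour (splitAt-join (n G) (n H) s) (splitAt-join (n G) (n H) t)

  module G-side = Hub colouring {K = G}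
    (_↑ˡ n H) (λ {a} {b} → ↑ˡ-injective (n H) a b) (join-adjˡˡ G H)
    (n G ↑ʳ h₀) (λ a → join-adjˡʳ G H a h₀) βG βG-alternating 0F 1F 2F (λ ()) (λ ()) (λ ())
    (trans (vcol-join (inj₂ h₀)) (cong (λ β → select (β ⁻¹) 1F 0F) βH-h₀))
    (λ {a} {b} _ → ecol-join (inj₁ a) (inj₁ b))
    (λ a → trans (ecol-join (inj₁ a) (inj₂ h₀)) (cross-to-h₀ a))
    (λ a → vcol-join (inj₁ a))

  module H-side = Hub colouring {K = H}
    (n G ↑ʳ_) (λ {a} {b} → ↑ʳ-injective (n G) a b) (join-adjʳʳ G H)
    (g₀ ↑ˡ n H) (λ b → join-adjʳˡ G H g₀ b) βH βH-alternating 2F 1F 0F (λ ()) (λ ()) (λ ())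
    (trans (vcol-join (inj₁ g₀)) (cong (λ β → select (β ⁻¹) 1F 2F) βG-g₀))
    (λ {a} {b} _ → ecol-join (inj₂ a) (inj₂ b))
    (λ b → trans (ecol-join (inj₂ b) (inj₁ g₀)) (cross-from-g₀ b))
    (λ b → vcol-join (inj₂ b))

  joined : ∀ s t → ∃ (IsTotalProperPath colouring (join (n G) (n H) s) (join (n G) (n H) t))
  joined (inj₁ a) (inj₁ b) = G-side.hub-connects a b
  joined (inj₂ a) (inj₂ b) = H-side.hub-connects a b
  joined (inj₁ a) (inj₂ b) = -, tpp-edge colouring (join-adjˡʳ G H a b)
  joined (inj₂ b) (inj₁ a) = -, tpp-edge colouring (join-adjʳˡ G H a b)

  total-proper-connected : TotalProperConnected (G ∨ᴳ H) colouring
  total-proper-connected x y =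
    subst₂ (λ x y → ∃ (IsTotalProperPath colouring x y))
      (join-splitAt (n G) (n H) x) (join-splitAt (n G) (n H) y)
      (joined (splitAt (n G) x) (splitAt (n G) y))

theorem2p1 : (G H : Graph) → Connected G → Connected H → ¬ Complete (G ∨ᴳ H) →
    TpcIs (G ∨ᴳ H) 3
theorem2p1 G H (nonempty-G , walks-G) (nonempty-H , walks-H) incomplete =
  (colouring , total-proper-connected) , tpc-lower-bound (G ∨ᴳ H) incomplete
  where
  g₀ : Fin (n G)
  g₀ = fromℕ< (>-nonZero⁻¹ (n G) {{nonempty-G}})
  h₀ : Fin (n H)
  h₀ = fromℕ< (>-nonZero⁻¹ (n H) {{nonempty-H}})
  module BFS-G = BreadthFirst G g₀ (walks-G g₀)
  module BFS-H = BreadthFirst H h₀ (walks-H h₀)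
  open JoinColouring G H (parity ∘ BFS-G.dist) (parity ∘ BFS-H.dist)
    BFS-G.dist-parity-root BFS-H.dist-parity-root
    BFS-G.dist-parity-alternating BFS-H.dist-parity-alternating
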